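{- There are (i) a formula $\psi\in\mathrm{ML}_{\to,\Diamond_g}(\Diamond_e)$ and (ii) a formula $\chi\in\mathrm{ML}_{\dot\vee,\Diamond_g}({=}(\cdot),\Diamond_e)$ that are not convex. There is (iii) a convex formula $\phi$ such that $\Diamond_g\phi$ is not convex.
   Context: Modal team semantics over Kripke models $M=(W,R,V)$, teams $t\subseteq W$. Write $tRs$ iff $s\subseteq R[t]$ and $t\subseteq R^{ -1}[s]$. The global modalities: $M,t\vDash\Diamond_g\phi$ iff there is $s\subseteq W$ with $tRs$ and $M,s\vDash\phi$; $M,t\vDash\Box_g\phi$ iff $M,R[t]\vDash\phi$. $\mathrm{ML}_{\to,\Diamond_g}(\Diamond_e)$ has connectives $p,\bot,\wedge,\to,\Diamond_e,\Diamond_g,\Box_g$; $\mathrm{ML}_{\dot\vee,\Diamond_g}({=}(\cdot),\Diamond_e)$ has $p,\bot,\wedge,\dot\vee$, negation of classical formulas, dependence atoms over classical formulas, $\Diamond_e,\Diamond_g,\Box_g$. Clauses: $t\vDash p$ iff $t\subseteq V(p)$; $t\vDash\bot$ iff $t=\emptyset$; $t\vDash\phi\to\psi$ iff every $s\subseteq t$ satisfying $\phi$ satisfies $\psi$; $t\vDash\phi\,\dot\vee\,\psi$ iff $t\subseteq s\cup u$ with $s\vDash\phi,u\vDash\psi$; $t\vDash\Diamond_e\phi$ ("epistemic might") iff some nonempty $s\subseteq t$ satisfies $\phi$. Convex: $s\vDash\phi$, $t\vDash\phi$, $s\subseteq u\subseteq t$ imply $u\vDash\phi$. -}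

module Defs where

open import Level using (Level; 0ℓ) renaming (suc to lsuc)
open import Data.Nat using (ℕ)
open import Data.Product using (Σ; _×_; _,_; ∃)
open import Data.Sum using (_⊎_)
open import Data.Empty using (⊥)
open import Data.List using (List)
open import Data.List.Relation.Unary.All using (All)
open import Relation.Nullary using (¬_)

Prop : Set
Prop = ℕ

record Model : Set₁ where
  field
    W : Set
    R : W → W → Set
    V : Prop → W → Set

data CForm : Set where
  atom  : Prop → CForm
  cbot  : CForm
  cneg  : CForm → CForm
  cand  : CForm → CForm → CForm
  cor   : CForm → CForm → CForm
  cdia  : CForm → CForm
  cbox  : CForm → CForm

_,_⊩_ : (M : Model) → Model.W M → CForm → Set
M , w ⊩ atom p   = Model.V M p w
M , w ⊩ cbot     = ⊥
M , w ⊩ cneg α   = ¬ (M , w ⊩ α)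
M , w ⊩ cand α β = (M , w ⊩ α) × (M , w ⊩ β)
M , w ⊩ cor α β  = (M , w ⊩ α) ⊎ (M , w ⊩ β)
M , w ⊩ cdia α   = Σ (Model.W M) λ v → Model.R M w v × (M , v ⊩ α)
M , w ⊩ cbox α   = ∀ v → Model.R M w v → M , v ⊩ α

data Form : Set where
  var    : Prop → Form
  bot    : Form
  and    : Form → Form → Form
  imp    : Form → Form → Form
  gdisj  : Form → Form → Form
  negc   : CForm → Form
  dep    : List CForm → CForm → Form
  diae   : Form → Form
  diag   : Form → Form
  boxg   : Form → Form

data InArrowLang : Form → Set where
  var  : ∀ p → InArrowLang (var p)
  bot  : InArrowLang bot
  and  : ∀ {φ ψ} → InArrowLang φ → InArrowLang ψ → InArrowLang (and φ ψ)
  imp  : ∀ {φ ψ} → InArrowLang φ → InArrowLang ψ → InArrowLang (imp φ ψ)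
  diae : ∀ {φ} → InArrowLang φ → InArrowLang (diae φ)
  diag : ∀ {φ} → InArrowLang φ → InArrowLang (diag φ)
  boxg : ∀ {φ} → InArrowLang φ → InArrowLang (boxg φ)

data InDisjLang : Form → Set where
  var   : ∀ p → InDisjLang (var p)
  bot   : InDisjLang bot
  and   : ∀ {φ ψ} → InDisjLang φ → InDisjLang ψ → InDisjLang (and φ ψ)
  gdisj : ∀ {φ ψ} → InDisjLang φ → InDisjLang ψ → InDisjLang (gdisj φ ψ)
  negc  : ∀ α → InDisjLang (negc α)
  dep   : ∀ αs β → InDisjLang (dep αs β)
  diae  : ∀ {φ} → InDisjLang φ → InDisjLang (diae φ)
  diag  : ∀ {φ} → InDisjLang φ → InDisjLang (diag φ)
  boxg  : ∀ {φ} → InDisjLang φ → InDisjLang (boxg φ)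

Team : Model → Set₁
Team M = Model.W M → Set

_⊆_ : {M : Model} → Team M → Team M → Set
_⊆_ {M} s t = ∀ w → s w → t w

image : (M : Model) → Team M → Team M
image M t v = Σ (Model.W M) λ w → t w × Model.R M w v

TeamR : (M : Model) → Team M → Team M → Set
TeamR M t s =
  (∀ v → s v → Σ (Model.W M) λ w → t w × Model.R M w v) ×
  (∀ w → t w → Σ (Model.W M) λ v → s v × Model.R M w v)

Iff : Set → Set → Set
Iff A B = (A → B) × (B → A)

sat : (M : Model) → Team M → Form → Set₁
sat M t (var p)     = Level.Lift (lsuc 0ℓ) (∀ w → t w → Model.V M p w)
sat M t bot         = Level.Lift (lsuc 0ℓ) (∀ w → ¬ t w)
sat M t (and φ ψ)   = sat M t φ × sat M t ψ
sat M t (imp φ ψ)   = (s : Team M) → _⊆_ {M} s t → sat M s φ → sat M s ψ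
sat M t (gdisj φ ψ) = Σ (Team M) λ s → Σ (Team M) λ u →
                        sat M s φ × sat M u ψ × Level.Lift (lsuc 0ℓ) (∀ w → t w → s w ⊎ u w)
sat M t (negc α)    = Level.Lift (lsuc 0ℓ) (∀ w → t w → ¬ (M , w ⊩ α))
sat M t (dep αs β)  = Level.Lift (lsuc 0ℓ) (∀ w v → t w → t v →
                        All (λ α → Iff (M , w ⊩ α) (M , v ⊩ α)) αs →
                        Iff (M , w ⊩ β) (M , v ⊩ β))
sat M t (diae φ)    = Σ (Team M) λ s →
                        Level.Lift (lsuc 0ℓ) (_⊆_ {M} s t × Σ (Model.W M) λ w → s w) × sat M s φ
sat M t (diag φ)    = Σ (Team M) λ s → Level.Lift (lsuc 0ℓ) (TeamR M t s) × sat M s φ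
sat M t (boxg φ)    = sat M (image M t) φ

Convex : Form → Set₁
Convex φ = (M : Model) (s u t : Team M) →
  sat M s φ → sat M t φ → _⊆_ {M} s u → _⊆_ {M} u t → sat M u φ

NotConvex : Form → Set₁
NotConvex φ = Σ Model λ M → Σ (Team M) λ s → Σ (Team M) λ u → Σ (Team M) λ t →
  sat M s φ × sat M t φ × Level.Lift (lsuc 0ℓ) (_⊆_ {M} s u × _⊆_ {M} u t) × ¬ sat M u φ

-- Both bodies ◇e q ∧ θ below say "◇e q, and p is uniform on the team", which is convex
-- (◇e is upward closed, → is downward closed).  In the model
--   a → x, a → x′,  b → y,  c → w,   p true at x,  q true at x and w,
-- the team {a} reaches {x} and {a,b,c} reaches {x′,y,w}, both of which satisfy
-- the body; but every successor team of {a,b} must contain y (for b) and, to see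
-- a q-world, x, on which p is not uniform.  So ◇g of the body fails on {a,b}.
module Submission where

open import Defs
open import Data.Empty using (⊥; ⊥-elim)
open import Data.List using ([])
open import Data.List.Relation.Unary.All using ([])
open import Data.Product using (Σ; _×_; _,_; proj₁)
open import Data.Unit using (⊤; tt)
open import Function.Bundles using (_⇔_; mk⇔; module Equivalence)
open import Level using (lift; lower)
open import Relation.Binary.PropositionalEquality using (_≡_; refl)
open import Relation.Nullary using (¬_)

open Equivalence using (to; from)

UpwardClosed DownwardClosed : Form → Set₁
UpwardClosed φ = (M : Model) (s t : Team M) → _⊆_ {M} s t → sat M s φ → sat M t φ
DownwardClosed φ = (M : Model) (s t : Team M) → _⊆_ {M} s t → sat M t φ → sat M s φ

upwardClosed∧downwardClosed⇒convex : ∀ {φ ψ} →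
  UpwardClosed φ → DownwardClosed ψ → Convex (and φ ψ)
upwardClosed∧downwardClosed⇒convex up down M s u t (sφ , _) (_ , tψ) s⊆u u⊆t =
  up M s u s⊆u sφ , down M u t u⊆t tψ

diae-upwardClosed : ∀ φ → UpwardClosed (diae φ)
diae-upwardClosed φ M s t s⊆t (r , lift (r⊆s , nonempty) , rφ) =
  r , lift ((λ w rw → s⊆t w (r⊆s w rw)) , nonempty) , rφ

imp-downwardClosed : ∀ φ ψ → DownwardClosed (imp φ ψ)
imp-downwardClosed φ ψ M s t s⊆t tφ→ψ r r⊆s = tφ→ψ r (λ w rw → s⊆t w (r⊆s w rw))

diae-var⇔witness : ∀ M (t : Team M) p →
  sat M t (diae (var p)) ⇔ Σ (Model.W M) λ w → t w × Model.V M p w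
diae-var⇔witness M t p = mk⇔
  (λ { (s , lift (s⊆t , w , sw) , lift sp) → w , s⊆t w sw , sp w sw })
  (λ { (w , tw , pw) →
       (λ v → v ≡ w) , lift ((λ { _ refl → tw }) , w , refl) , lift (λ { _ refl → pw }) })

Uniform : (M : Model) → Team M → CForm → Set
Uniform M t α = ∀ w v → t w → t v → M , w ⊩ α → M , v ⊩ α

uniform-if-everywhere : ∀ {M} {t : Team M} {α} → (∀ w → t w → M , w ⊩ α) → Uniform M t α
uniform-if-everywhere α-everywhere w v _ tv _ = α-everywhere v tv

uniform-if-nowhere : ∀ {M} {t : Team M} {α} → (∀ w → t w → ¬ (M , w ⊩ α)) → Uniform M t α
uniform-if-nowhere α-nowhere w v tw _ wα = ⊥-elim (α-nowhere w tw wα)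

dep-constant⇔uniform : ∀ M (t : Team M) α → sat M t (dep [] α) ⇔ Uniform M t α
dep-constant⇔uniform M t α = mk⇔
  (λ { (lift d) w v tw tv → proj₁ (d w v tw tv []) })
  (λ u → lift (λ w v tw tv _ → u w v tw tv , u v w tv tw))

diae-var→var⇔uniform : ∀ M (t : Team M) p →
  sat M t (imp (diae (var p)) (var p)) ⇔ Uniform M t (atom p)
diae-var→var⇔uniform M t p = mk⇔
  (λ might→p w v tw tv pw →
     lower (might→p t (λ _ tu → tu) (from (diae-var⇔witness M t p) (w , tw , pw))) v tv)
  (λ u r r⊆t might → let (w , rw , pw) = to (diae-var⇔witness M r p) might in
     lift (λ v rv → u w v (r⊆t w rw) (r⊆t v rv) pw))

data World : Set where
  a b c x x′ y w : World

Access : World → World → Set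
Access a x  = ⊤
Access a x′ = ⊤
Access b y  = ⊤
Access c w  = ⊤
Access _ _  = ⊥

p q : Prop
p = 0
q = 1

Val : Prop → World → Set
Val 0 x = ⊤
Val 1 x = ⊤
Val 1 w = ⊤
Val _ _ = ⊥

model : Model
model = record { W = World ; R = Access ; V = Val }

A AB ABC X X′YW : Team model
A a = ⊤
A _ = ⊥
AB a = ⊤
AB b = ⊤
AB _ = ⊥
ABC c = ⊤
ABC v = AB v
X x = ⊤
X _ = ⊥
X′YW x′ = ⊤
X′YW y  = ⊤
X′YW w  = ⊤
X′YW _  = ⊥

A→X : TeamR model A X
A→X = (λ { x _ → a , tt , tt }) , (λ { a _ → x , tt , tt })

ABC→X′YW : TeamR model ABC X′YW
ABC→X′YW =
  (λ { x′ _ → a , tt , tt ; y _ → b , tt , tt ; w _ → c , tt , tt }) ,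
  (λ { a _ → x′ , tt , tt ; b _ → y , tt , tt ; c _ → w , tt , tt })

-- The only q-worlds are x and w, and w is seen only from c ∉ AB.
successor-of-AB-seeing-q : ∀ (s : Team model) → TeamR model AB s →
  Σ World (λ v → s v × Val q v) → s x × s y
successor-of-AB-seeing-q s (back , forth) (v , sv , qv) = sees-x v sv qv , sees-y
  where
  sees-x : ∀ v → s v → Val q v → s x
  sees-x x sx _ = sx
  sees-x w sw _ with back w sw
  ... | a , _ , ()
  ... | b , _ , ()
  sees-y : s y
  sees-y with forth b tt
  ... | y , sy , _ = sy

diag-might-q∧uniform-p-not-convex : ∀ θ →
  (∀ s → sat model s θ ⇔ Uniform model s (atom p)) → NotConvex (diag (and (diae (var q)) θ))
diag-might-q∧uniform-p-not-convex θ θ⇔uniform =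
  model , A , AB , ABC , sat-A , sat-ABC , lift (A⊆AB , AB⊆ABC) , unsat-AB
  where
  sat-A : sat model A (diag (and (diae (var q)) θ))
  sat-A = X , lift A→X ,
    from (diae-var⇔witness model X q) (x , tt , tt) ,
    from (θ⇔uniform X) (uniform-if-everywhere {model} {X} {atom p} λ { x _ → tt })
  sat-ABC : sat model ABC (diag (and (diae (var q)) θ))
  sat-ABC = X′YW , lift ABC→X′YW ,
    from (diae-var⇔witness model X′YW q) (w , tt , tt) ,
    from (θ⇔uniform X′YW) (uniform-if-nowhere {model} {X′YW} {atom p} λ { x′ _ () ; y _ () ; w _ () })
  A⊆AB : _⊆_ {model} A AB
  A⊆AB a _ = tt
  AB⊆ABC : _⊆_ {model} AB ABC
  AB⊆ABC a _ = tt
  AB⊆ABC b _ = tt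
  unsat-AB : ¬ sat model AB (diag (and (diae (var q)) θ))
  unsat-AB (s , lift ABRs , might-q , sθ)
    with successor-of-AB-seeing-q s ABRs (to (diae-var⇔witness model s q) might-q)
  ... | sx , sy = to (θ⇔uniform s) sθ x y sx sy tt

fact2p20 : (Σ Form λ ψ → InArrowLang ψ × NotConvex ψ)
         × (Σ Form λ χ → InDisjLang χ × NotConvex χ)
         × (Σ Form λ φ → Convex φ × NotConvex (diag φ))
fact2p20 =
  (diag φ , diag (and (diae (var q)) (imp (diae (var p)) (var p))) , φ-not-convex) ,
  (diag χ , diag (and (diae (var q)) (dep [] (atom p))) , χ-not-convex) ,
  (φ , φ-convex , φ-not-convex)
  where
  φ χ : Form
  φ = and (diae (var q)) (imp (diae (var p)) (var p))
  χ = and (diae (var q)) (dep [] (atom p))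
  φ-convex : Convex φ
  φ-convex = upwardClosed∧downwardClosed⇒convex {diae (var q)} {imp (diae (var p)) (var p)}
    (diae-upwardClosed (var q)) (imp-downwardClosed (diae (var p)) (var p))
  φ-not-convex : NotConvex (diag φ)
  φ-not-convex = diag-might-q∧uniform-p-not-convex (imp (diae (var p)) (var p))
    (λ s → diae-var→var⇔uniform model s p)
  χ-not-convex : NotConvex (diag χ)
  χ-not-convex = diag-might-q∧uniform-p-not-convex (dep [] (atom p))
    (λ s → dep-constant⇔uniform model s (atom p))
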